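{- For $g_1,g_2\in\tilde{\mathrm{CH}}_2$ with $g_1\in\mathrm{Ker}(L)$, we have $g_1g_2=0$.
   Context: $\tau(i)=|i+1|-1$. $\tilde{\mathrm{CH}}_2$: the ring generated by $\tilde h_i$, $i\in\mathbb{Z}$; its elements are finite integer linear combinations of the linearly independent symbols $\tilde h_i$, with bilinear multiplication $\tilde h_{ -1}\tilde h_j=0$, $\tilde h_i\tilde h_j=\sum_{k=0}^i\tilde h_{j-i+2k}$ for $i\ge0$, and $\tilde h_i\tilde h_j=-\tilde h_{\tau(i)}\tilde h_j$ for $i<-1$. $\mathrm{CH}_2$: finite integer linear combinations of linearly independent symbols $h_i$, $i\ge0$ (with $h_ih_j=\sum_{k=0}^{\min(i,j)}h_{|j-i|+2k}$). $L:\tilde{\mathrm{CH}}_2\to\mathrm{CH}_2$ is the linear map (ring homomorphism) $L(\tilde h_i)=\mathrm{sgn}(i+1)h_{\tau(i)}$, so $L(\tilde h_{ -1})=0$; $\mathrm{Ker}(L)$ is its kernel. -}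

module Defs where

open import Data.Nat using (ℕ; zero; suc)
open import Data.Integer using (ℤ; +_; -[1+_]; _+_; _-_; _*_; -_; 0ℤ; 1ℤ)
import Data.Integer.Properties as ℤP
import Data.Nat.Properties as ℕP
open import Data.List using (List; []; _∷_; map; concatMap; upTo)
open import Data.Product using (_×_; _,_)
open import Relation.Binary.PropositionalEquality using (_≡_)
open import Relation.Binary.Definitions using (DecidableEquality)
open import Relation.Nullary using (yes; no)

-- A formal finite integer linear combination of basis symbols indexed by I,
-- represented as a list of (coefficient , index) pairs.  Two such lists denote
-- the same element iff they have the same coefficient function.
FormalSum : Set → Set
FormalSum I = List (ℤ × I)

coeff : {I : Set} → DecidableEquality I → FormalSum I → I → ℤ
coeff _≟_ [] n = 0ℤ
coeff _≟_ ((a , i) ∷ xs) n with i ≟ n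
... | yes _ = a + coeff _≟_ xs n
... | no  _ = coeff _≟_ xs n

scale : {I : Set} → ℤ → FormalSum I → FormalSum I
scale c = map (λ { (a , i) → (c * a , i) })

CHt₂ : Set
CHt₂ = FormalSum ℤ

CH₂ : Set
CH₂ = FormalSum ℕ

ht : ℤ → CHt₂
ht i = (1ℤ , i) ∷ []

IsZeroCHt : CHt₂ → Set
IsZeroCHt g = ∀ n → coeff ℤP._≟_ g n ≡ 0ℤ

IsZeroCH : CH₂ → Set
IsZeroCH g = ∀ n → coeff ℕP._≟_ g n ≡ 0ℤ

-- τ(i) = |i+1| - 1
-- product of basis elements h̃_i h̃_j:
--   i ≥ 0   : Σ_{k=0}^{i} h̃_{j-i+2k}
--   i = -1  : 0
--   i < -1  : - h̃_{τ(i)} h̃_j,  where τ(-(m+2)) = m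
basisMul : ℤ → ℤ → CHt₂
basisMul (+ n) j = map (λ k → (1ℤ , j - + n + (+ 2) * (+ k))) (upTo (suc n))
basisMul -[1+ zero ] j = []
basisMul -[1+ suc m ] j = scale (- 1ℤ) (basisMul (+ m) j)

mul : CHt₂ → CHt₂ → CHt₂
mul g₁ g₂ = concatMap (λ { (a , i) → concatMap (λ { (b , j) → scale (a * b) (basisMul i j) }) g₂ }) g₁

-- L(h̃_i) = sgn(i+1) h_{τ(i)} : for i ≥ 0 this is h_i, for i = -1 it is 0,
-- for i = -(m+2) it is -h_m.
Lbasis : ℤ → CH₂
Lbasis (+ n) = (1ℤ , n) ∷ []
Lbasis -[1+ zero ] = []
Lbasis -[1+ suc m ] = (- 1ℤ , m) ∷ []

L : CHt₂ → CH₂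
L g = concatMap (λ { (a , i) → scale a (Lbasis i) }) g

InKerL : CHt₂ → Set
InKerL g = IsZeroCH (L g)

-- The coefficient of h̃_n in g₁g₂ is a linear functional of g₁: it is Σ aᵢ G(i) for
-- g₁ = Σ aᵢ h̃ᵢ, where G(i) is the coefficient of h̃_n in h̃ᵢg₂.  The multiplication
-- rules h̃₋₁h̃ⱼ = 0 and h̃_{-(m+2)}h̃ⱼ = -h̃_m h̃ⱼ make G odd under the reflection
-- i ↦ -2-i, and every such functional factors through L: Σ aᵢ G(i) = Σ bₘ G(m) where
-- L(g₁) = Σ bₘ hₘ.  So it vanishes once all coefficients of L(g₁) do.
module Submission where

open import Defs
open import Data.Nat using (suc)
open import Data.Integer using (ℤ; +_; -[1+_]; _+_; _*_; -_; 0ℤ; 1ℤ; -1ℤ)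
import Data.Integer.Properties as ℤP
import Data.Nat.Properties as ℕP
open import Data.Integer.Tactic.RingSolver using (solve-∀)
open import Data.List using ([]; _∷_; _++_; concatMap)
open import Data.Product using (_,_)
open import Function using (_∘_)
open import Relation.Binary.Definitions using (DecidableEquality)
open import Relation.Binary.PropositionalEquality
open import Relation.Nullary using (yes; no; ¬_; contradiction)

eval : {I : Set} → FormalSum I → (I → ℤ) → ℤ
eval [] F = 0ℤ
eval ((a , i) ∷ h) F = a * F i + eval h F

module _ {I : Set} where

  eval-++ : ∀ (h h′ : FormalSum I) F → eval (h ++ h′) F ≡ eval h F + eval h′ F
  eval-++ [] h′ F = sym (ℤP.+-identityˡ _)
  eval-++ ((a , i) ∷ h) h′ F =
    trans (cong (_+_ (a * F i)) (eval-++ h h′ F)) (sym (ℤP.+-assoc (a * F i) _ _))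

  eval-scale : ∀ c (h : FormalSum I) F → eval (scale c h) F ≡ c * eval h F
  eval-scale c [] F = sym (ℤP.*-zeroʳ c)
  eval-scale c ((a , i) ∷ h) F = begin
    c * a * F i + eval (scale c h) F ≡⟨ cong (_+_ (c * a * F i)) (eval-scale c h F) ⟩
    c * a * F i + c * eval h F       ≡⟨ cong (_+ c * eval h F) (ℤP.*-assoc c a (F i)) ⟩
    c * (a * F i) + c * eval h F     ≡⟨ ℤP.*-distribˡ-+ c (a * F i) (eval h F) ⟨
    c * (a * F i + eval h F)         ∎
    where open ≡-Reasoning

  eval-*ˡ : ∀ c (h : FormalSum I) F → eval h (λ i → c * F i) ≡ c * eval h F
  eval-*ˡ c [] F = sym (ℤP.*-zeroʳ c)
  eval-*ˡ c ((a , i) ∷ h) F = begin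
    a * (c * F i) + eval h (λ i → c * F i) ≡⟨ cong (_+_ (a * (c * F i))) (eval-*ˡ c h F) ⟩
    a * (c * F i) + c * eval h F           ≡⟨ lemma a c (F i) (eval h F) ⟩
    c * (a * F i + eval h F)               ∎
    where
    open ≡-Reasoning
    lemma : ∀ a c x e → a * (c * x) + c * e ≡ c * (a * x + e)
    lemma = solve-∀

  eval-const-0 : ∀ (h : FormalSum I) → eval h (λ _ → 0ℤ) ≡ 0ℤ
  eval-const-0 [] = refl
  eval-const-0 ((a , _) ∷ h) = cong₂ _+_ (ℤP.*-zeroʳ a) (eval-const-0 h)

  eval-concatMap-scale : ∀ {J : Set} a (f : J → FormalSum I) g F →
                         eval (concatMap (λ (b , j) → scale (a * b) (f j)) g) F
                           ≡ a * eval g (λ j → eval (f j) F)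
  eval-concatMap-scale a f [] F = sym (ℤP.*-zeroʳ a)
  eval-concatMap-scale a f ((b , j) ∷ g) F = begin
    eval (scale (a * b) (f j) ++ rest) F       ≡⟨ eval-++ (scale (a * b) (f j)) rest F ⟩
    eval (scale (a * b) (f j)) F + eval rest F ≡⟨ cong₂ _+_ (eval-scale (a * b) (f j) F)
                                                          (eval-concatMap-scale a f g F) ⟩
    a * b * x + a * e                          ≡⟨ lemma a b x e ⟩
    a * (b * x + e)                            ∎
    where
    open ≡-Reasoning
    rest = concatMap (λ (b , j) → scale (a * b) (f j)) g
    x = eval (f j) F
    e = eval g (λ j → eval (f j) F)
    lemma : ∀ a b x e → a * b * x + a * e ≡ a * (b * x + e)
    lemma = solve-∀

  eval-cong : ∀ (h : FormalSum I) {F G : I → ℤ} → (∀ i → F i ≡ G i) → eval h F ≡ eval h G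
  eval-cong [] F≗G = refl
  eval-cong ((a , i) ∷ h) F≗G = cong₂ (λ x y → a * x + y) (F≗G i) (eval-cong h F≗G)

module _ {I : Set} (_≟_ : DecidableEquality I) where

  δ : I → I → ℤ
  δ n i with i ≟ n
  ... | yes _ = 1ℤ
  ... | no  _ = 0ℤ

  coeff≡eval-δ : ∀ (h : FormalSum I) n → coeff _≟_ h n ≡ eval h (δ n)
  coeff≡eval-δ [] n = refl
  coeff≡eval-δ ((a , i) ∷ h) n with i ≟ n
  ... | yes _ = cong₂ _+_ (sym (ℤP.*-identityʳ a)) (coeff≡eval-δ h n)
  ... | no  _ = begin
    coeff _≟_ h n         ≡⟨ coeff≡eval-δ h n ⟩
    eval h (δ n)          ≡⟨ ℤP.+-identityˡ _ ⟨
    0ℤ + eval h (δ n)     ≡⟨ cong (_+ eval h (δ n)) (ℤP.*-zeroʳ a) ⟨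
    a * 0ℤ + eval h (δ n) ∎
    where open ≡-Reasoning

  coeff-∷-≢ : ∀ {a i} (h : FormalSum I) {k} → ¬ i ≡ k → coeff _≟_ ((a , i) ∷ h) k ≡ coeff _≟_ h k
  coeff-∷-≢ {i = i} h {k} i≢k with i ≟ k
  ... | yes i≡k = contradiction i≡k i≢k
  ... | no  _   = refl

  without : I → (I → ℤ) → I → ℤ
  without n F i with i ≟ n
  ... | yes _ = 0ℤ
  ... | no  _ = F i

  without-self : ∀ n F → without n F n ≡ 0ℤ
  without-self n F with n ≟ n
  ... | yes _   = refl
  ... | no  n≢n = contradiction refl n≢n

  eval-split : ∀ (h : FormalSum I) n F →
               eval h F ≡ coeff _≟_ h n * F n + eval h (without n F)
  eval-split [] n F = refl
  eval-split ((a , i) ∷ h) n F with i ≟ n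
  ... | yes refl = begin
    a * F i + eval h F                                ≡⟨ cong (_+_ (a * F i)) (eval-split h i F) ⟩
    a * F i + (coeff _≟_ h i * F i + eval h F′)       ≡⟨ lemma a (coeff _≟_ h i) (F i) (eval h F′) ⟩
    (a + coeff _≟_ h i) * F i + (a * 0ℤ + eval h F′)  ∎
    where
    open ≡-Reasoning
    F′ = without i F
    lemma : ∀ a c x e → a * x + (c * x + e) ≡ (a + c) * x + (a * 0ℤ + e)
    lemma = solve-∀
  ... | no _ = begin
    a * F i + eval h F                            ≡⟨ cong (_+_ (a * F i)) (eval-split h n F) ⟩
    a * F i + (coeff _≟_ h n * F n + eval h F′)   ≡⟨ lemma (a * F i) (coeff _≟_ h n * F n) (eval h F′) ⟩
    coeff _≟_ h n * F n + (a * F i + eval h F′)   ∎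
    where
    open ≡-Reasoning
    F′ = without n F
    lemma : ∀ x y e → x + (y + e) ≡ y + (x + e)
    lemma = solve-∀

  -- Induct on h while zeroing F at the head index: the head's total coefficient is
  -- then accounted for once, and the tail still satisfies the hypothesis.
  eval-vanishes : ∀ (h : FormalSum I) F → (∀ k → coeff _≟_ h k * F k ≡ 0ℤ) → eval h F ≡ 0ℤ
  eval-vanishes [] F _ = refl
  eval-vanishes h@((a , n) ∷ t) F vanish = begin
    eval h F                                                         ≡⟨ eval-split h n F ⟩
    coeff _≟_ h n * F n + (a * without n F n + eval t (without n F)) ≡⟨ cong₂ _+_ (vanish n) tail-vanishes ⟩
    0ℤ                                                               ∎
    where
    open ≡-Reasoning
    vanish′ : ∀ k → coeff _≟_ t k * without n F k ≡ 0ℤ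
    vanish′ k with k ≟ n
    ... | yes _   = ℤP.*-zeroʳ (coeff _≟_ t k)
    ... | no  k≢n = trans (cong (_* F k) (sym (coeff-∷-≢ t (k≢n ∘ sym)))) (vanish k)
    tail-vanishes : a * without n F n + eval t (without n F) ≡ 0ℤ
    tail-vanishes = cong₂ _+_ (trans (cong (a *_) (without-self n F)) (ℤP.*-zeroʳ a))
                              (eval-vanishes t (without n F) vanish′)

  eval-of-zero : ∀ (h : FormalSum I) → (∀ k → coeff _≟_ h k ≡ 0ℤ) → ∀ F → eval h F ≡ 0ℤ
  eval-of-zero h h≡0 F = eval-vanishes h F (λ k → cong (_* F k) (h≡0 k))

evalBasisMul : CHt₂ → (ℤ → ℤ) → ℤ → ℤ
evalBasisMul g₂ F i = eval g₂ (λ j → eval (basisMul i j) F)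

eval-mul : ∀ g₁ g₂ F → eval (mul g₁ g₂) F ≡ eval g₁ (evalBasisMul g₂ F)
eval-mul [] g₂ F = refl
eval-mul ((a , i) ∷ g₁) g₂ F = begin
  eval (row ++ mul g₁ g₂) F                             ≡⟨ eval-++ row (mul g₁ g₂) F ⟩
  eval row F + eval (mul g₁ g₂) F                       ≡⟨ cong₂ _+_ (eval-concatMap-scale a (basisMul i) g₂ F)
                                                                     (eval-mul g₁ g₂ F) ⟩
  a * evalBasisMul g₂ F i + eval g₁ (evalBasisMul g₂ F) ∎
  where
  open ≡-Reasoning
  row = concatMap (λ (b , j) → scale (a * b) (basisMul i j)) g₂

-- Oddness under the reflection i ↦ -2-i, i.e. G(i) = sgn(i+1) G(τ(i)).
record ReflectionOdd (G : ℤ → ℤ) : Set where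
  field
    at-−1   : G -[1+ 0 ] ≡ 0ℤ
    reflect : ∀ m → G -[1+ suc m ] ≡ - G (+ m)

evalBasisMul-odd : ∀ g₂ F → ReflectionOdd (evalBasisMul g₂ F)
evalBasisMul-odd g₂ F = record { at-−1 = eval-const-0 g₂ ; reflect = reflect }
  where
  open ≡-Reasoning
  reflect : ∀ m → evalBasisMul g₂ F -[1+ suc m ] ≡ - evalBasisMul g₂ F (+ m)
  reflect m = begin
    eval g₂ (λ j → eval (scale -1ℤ (basisMul (+ m) j)) F) ≡⟨ eval-cong g₂ (λ j → eval-scale -1ℤ (basisMul (+ m) j) F) ⟩
    eval g₂ (λ j → -1ℤ * eval (basisMul (+ m) j) F)       ≡⟨ eval-*ˡ -1ℤ g₂ (λ j → eval (basisMul (+ m) j) F) ⟩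
    -1ℤ * evalBasisMul g₂ F (+ m)                         ≡⟨ ℤP.-1*i≡-i _ ⟩
    - evalBasisMul g₂ F (+ m)                             ∎

eval-L : ∀ {G} → ReflectionOdd G → ∀ g → eval (L g) (G ∘ +_) ≡ eval g G
eval-L odd [] = refl
eval-L {G} odd ((a , i) ∷ g) = begin
  eval (scale a (Lbasis i) ++ L g) (G ∘ +_)                ≡⟨ eval-++ (scale a (Lbasis i)) (L g) (G ∘ +_) ⟩
  eval (scale a (Lbasis i)) (G ∘ +_) + eval (L g) (G ∘ +_) ≡⟨ cong₂ _+_ (eval-scale a (Lbasis i) (G ∘ +_))
                                                                        (eval-L odd g) ⟩
  a * eval (Lbasis i) (G ∘ +_) + eval g G                  ≡⟨ cong (λ x → a * x + eval g G) (eval-Lbasis i) ⟩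
  a * G i + eval g G                                       ∎
  where
  open ≡-Reasoning
  open ReflectionOdd odd
  eval-Lbasis : ∀ i → eval (Lbasis i) (G ∘ +_) ≡ G i
  eval-Lbasis (+ n)        = trans (ℤP.+-identityʳ _) (ℤP.*-identityˡ _)
  eval-Lbasis -[1+ 0 ]     = sym at-−1
  eval-Lbasis -[1+ suc m ] = trans (ℤP.+-identityʳ _) (trans (ℤP.-1*i≡-i _) (sym (reflect m)))

lemma3p8 : (g₁ g₂ : CHt₂) → InKerL g₁ → IsZeroCHt (mul g₁ g₂)
lemma3p8 g₁ g₂ L[g₁]≡0 n = begin
  coeff ℤP._≟_ (mul g₁ g₂) n ≡⟨ coeff≡eval-δ ℤP._≟_ (mul g₁ g₂) n ⟩
  eval (mul g₁ g₂) δₙ        ≡⟨ eval-mul g₁ g₂ δₙ ⟩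
  eval g₁ G                  ≡⟨ eval-L (evalBasisMul-odd g₂ δₙ) g₁ ⟨
  eval (L g₁) (G ∘ +_)       ≡⟨ eval-of-zero ℕP._≟_ (L g₁) L[g₁]≡0 (G ∘ +_) ⟩
  0ℤ                         ∎
  where
  open ≡-Reasoning
  δₙ = δ ℤP._≟_ n
  G = evalBasisMul g₂ δₙ
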